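{- Let $\mathcal{W}=(\mathcal{L},f)$ be a weighted lattice. Suppose there exists $\theta\in\mathbb{R}_{>0}$ such that $\mathbb{P}(\mathcal{W}';\theta)\ge 0$ for every minor $\mathcal{W}'$ of $\mathcal{W}$. Let $T\in\mathcal{L}$ be such that $\mathbb{P}(\mathcal{W}/T;\theta)>0$. If $U$ is a complement of $T$ in $\mathcal{L}$, then $\mathbb{P}(\mathcal{W}|_U;\theta)>0$.
   Context: $\mathcal{L}$ is a finite modular complemented lattice with least element $\mathbf{0}$ and greatest element $\mathbf{1}$; a complement of $T$ is $U$ with $T\wedge U=\mathbf 0$ and $T\vee U=\mathbf 1$; $\mu$ is its Möbius function. A weighted lattice is $\mathcal{W}=(\mathcal{L},f)$ with $f:\mathcal{L}\to\mathbb{N}_0$, $f(\mathbf{0})=0$, $f$ monotone. For $X\le Y$, the minor $\mathcal{W}([X,Y])$ is the weighted lattice on $[X,Y]$ with weight $T\mapsto f(T)-f(X)$; $\mathcal{W}|_Y=\mathcal{W}([\mathbf{0},Y])$, $\mathcal{W}/X=\mathcal{W}([X,\mathbf{1}])$. Characteristic polynomial: $\mathbb{P}(\mathcal{W}([X,Y]);z)=\sum_{A\in[X,Y]}\mu(X,A)z^{f(Y)-f(A)}$. -}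

module Defs where

open import Data.Nat as ℕ using (ℕ; zero; suc; _∸_)
open import Data.Integer as ℤ using (ℤ; +_; -[1+_])
open import Data.Fin using (Fin)
open import Data.Fin.Properties using () renaming (_≟_ to _≟ᶠ_)
open import Data.List using (List; []; _∷_; _∷ʳ_; length; foldr; filter; allFin)
open import Data.Product using (Σ; ∃; _×_; _,_)
open import Data.Sum using (_⊎_)
open import Data.Bool using (Bool; true; false; not) renaming (_∧_ to _and_)
open import Relation.Nullary using (¬_; does)
open import Relation.Binary.PropositionalEquality using (_≡_)
open import Relation.Binary.Core using (Rel)
open import Relation.Binary.Definitions using (Decidable)
open import Relation.Binary.Structures using (IsStrictTotalOrder)
open import Relation.Binary.Lattice.Structures using (IsBoundedLattice)
open import Algebra.Structures using (IsCommutativeRing)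

-- The paper evaluates integer polynomials at a real
-- θ > 0; ℝ is not available, so we quantify over every real closed field
-- (ordered field + square roots of positives + roots of odd-degree
-- polynomials).  By Tarski transfer the statement for a fixed finite
-- weighted lattice holds in ℝ iff it holds in every real closed field.

evalPoly : {A : Set} → (A → A → A) → (A → A → A) → A → List A → A → A
evalPoly _+_ _*_ 0# [] x = 0#
evalPoly _+_ _*_ 0# (c ∷ cs) x = c + (x * evalPoly _+_ _*_ 0# cs x)

record RealClosedField : Set₁ where
  infixl 6 _+_
  infixl 7 _*_
  infix 4 _<_
  field
    Carrier : Set
    _+_ _*_ : Carrier → Carrier → Carrier
    -_ : Carrier → Carrier
    0# 1# : Carrier
    _<_ : Rel Carrier _
    isCommutativeRing : IsCommutativeRing _≡_ _+_ _*_ -_ 0# 1#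
    isStrictTotalOrder : IsStrictTotalOrder _≡_ _<_
    0≢1 : ¬ (0# ≡ 1#)
    +-mono-< : ∀ {x y} z → x < y → x + z < y + z
    *-pos : ∀ {x y} → 0# < x → 0# < y → 0# < x * y
    inverse : ∀ x → ¬ (x ≡ 0#) → ∃ λ y → x * y ≡ 1#
    sqrt : ∀ x → 0# < x → ∃ λ y → y * y ≡ x
    oddRoot : ∀ (cs : List Carrier) (c : Carrier) → ¬ (c ≡ 0#) →
              (∃ λ k → length cs ≡ suc (2 ℕ.* k)) →
              ∃ λ x → evalPoly _+_ _*_ 0# (cs ∷ʳ c) x ≡ 0#

  _≤_ : Rel Carrier _
  x ≤ y = x < y ⊎ x ≡ y

  _^_ : Carrier → ℕ → Carrier
  x ^ zero = 1#
  x ^ suc k = x * (x ^ k)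

  fromℕ : ℕ → Carrier
  fromℕ zero = 0#
  fromℕ (suc k) = 1# + fromℕ k

  fromℤ : ℤ → Carrier
  fromℤ (+ k) = fromℕ k
  fromℤ -[1+ k ] = - fromℕ (suc k)

  sumF : List Carrier → Carrier
  sumF = foldr _+_ 0#

record FinModLattice : Set₁ where
  field
    n : ℕ
    _≤_ : Rel (Fin n) _
    _≤?_ : Decidable _≤_
    _∨_ _∧_ : Fin n → Fin n → Fin n
    𝟏 𝟎 : Fin n
    isBoundedLattice : IsBoundedLattice _≡_ _≤_ _∨_ _∧_ 𝟏 𝟎
    modular : ∀ x y z → x ≤ z → (x ∨ (y ∧ z)) ≡ ((x ∨ y) ∧ z)

  Carrier : Set
  Carrier = Fin n

  IsComplement : Carrier → Carrier → Set
  IsComplement T U = ((T ∧ U) ≡ 𝟎) × ((T ∨ U) ≡ 𝟏)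

  field
    complemented : ∀ x → ∃ λ y → IsComplement x y

  inInterval : Carrier → Carrier → Carrier → Bool
  inInterval X Y A = does (X ≤? A) and does (A ≤? Y)

  halfOpen : Carrier → Carrier → List Carrier
  halfOpen X Y = filter (λ Z → Data.Bool.T? (inInterval X Y Z and not (does (Z ≟ᶠ Y)))) (allFin n)
    where import Data.Bool

  interval : Carrier → Carrier → List Carrier
  interval X Y = filter (λ Z → Data.Bool.T? (inInterval X Y Z)) (allFin n)
    where import Data.Bool

  -- Möbius function with fuel: μ(X,X) = 1, μ(X,Y) = - Σ_{X ≤ Z < Y} μ(X,Z)
  -- for X < Y, and 0 if X ≰ Y.  Fuel n suffices (chains have ≤ n elements).
  möbiusFuel : ℕ → Carrier → Carrier → ℤ
  möbiusFuel k X Y with does (X ≟ᶠ Y) | does (X ≤? Y)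
  ... | true  | _     = ℤ.+ 1
  ... | false | false = ℤ.+ 0
  ... | false | true with k
  ...   | zero  = ℤ.+ 0
  ...   | suc k' = ℤ.- foldr ℤ._+_ (ℤ.+ 0) (Data.List.map (möbiusFuel k' X) (halfOpen X Y))
    where import Data.List

  μ : Carrier → Carrier → ℤ
  μ = möbiusFuel n

record WeightedLattice : Set₁ where
  field
    lattice : FinModLattice
  open FinModLattice lattice
  field
    f : Carrier → ℕ
    f-𝟎 : f 𝟎 ≡ 0
    f-mono : ∀ {X Y} → X ≤ Y → f X ℕ.≤ f Y

-- Characteristic polynomial of the minor W([X,Y]) evaluated at θ ∈ F:
--   P(W([X,Y]); θ) = Σ_{A ∈ [X,Y]} μ(X,A) θ^(f(Y) - f(A)).
charPoly : (F : RealClosedField) (W : WeightedLattice) →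
           FinModLattice.Carrier (WeightedLattice.lattice W) →
           FinModLattice.Carrier (WeightedLattice.lattice W) →
           RealClosedField.Carrier F → RealClosedField.Carrier F
charPoly F W X Y θ =
  sumF (Data.List.map (λ A → fromℤ (μ X A) * (θ ^ (f Y ∸ f A))) (interval X Y))
  where
    open RealClosedField F
    open WeightedLattice W
    open FinModLattice lattice
    import Data.List

{-# OPTIONS --safe #-}
-- Write χ(X,Y) = ℙ(𝒲([X,Y]); θ).  Möbius inversion over the upper interval [A,𝟏] gives
-- Σ_{B ≥ A} χ(B,𝟏) = θ^(f 𝟏 - f A).  Substituting this into
-- χ(𝟎,U) θ^(f 𝟏 - f U) = Σ_{A ≤ U} μ(𝟎,A) θ^(f 𝟏 - f A) and summing over A first, the
-- inner sums Σ_{A ≤ B ∧ U} μ(𝟎,A) vanish unless B ∧ U = 𝟎, so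
--   χ(𝟎,U) θ^(f 𝟏 - f U) = Σ_{B ∧ U = 𝟎} χ(B,𝟏).
-- Every summand is nonnegative and the one for B = T is positive; hence the product is
-- positive, and so is its nonnegative factor χ(𝟎,U).
module Submission where

open import Defs

open import Algebra.Bundles using (CommutativeRing; AbelianGroup)
open import Algebra.Structures using (IsCommutativeRing)
open import Data.Bool using (Bool; true; false; not; if_then_else_; T) renaming (_∧_ to _and_)
open import Data.Bool.Properties using (T?; T-∧)
open import Data.Empty using (⊥-elim)
open import Data.Fin using (Fin; zero; suc)
open import Data.Fin.Properties using () renaming (_≟_ to _≟ᶠ_)
open import Data.Integer as ℤ using (ℤ; 0ℤ; 1ℤ; -[1+_]; _⊖_)
import Data.Integer.Properties as ℤ
open import Data.List using ([]; _∷_; length; foldr; map; filter; tabulate; allFin)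
open import Data.List.Membership.Propositional using (_∈_)
open import Data.List.Membership.Propositional.Properties using (∈-allFin)
open import Data.List.Properties using (length-filter; length-tabulate; filter-some)
open import Data.List.Relation.Unary.Any as Any using (here; there)
open import Data.Nat as ℕ using (ℕ; zero; suc; z≤n; s≤s; _∸_)
import Data.Nat.Properties as ℕ
open import Data.Product using (_×_; _,_)
open import Data.Sum using (inj₁; inj₂)
open import Function using (_∘_; id; _⇔_; mk⇔; Equivalence)
open import Relation.Binary.Lattice.Structures using (IsBoundedLattice)
open import Relation.Binary.PropositionalEquality
open import Relation.Binary.Structures using (IsStrictTotalOrder)
open import Relation.Nullary using (¬_; Dec; does; yes; no)

module _ {A : Set} (p q : A → Bool) (p⇒q : ∀ {x} → T (p x) → T (q x)) where

  length-filter-mono : ∀ xs → length (filter (T? ∘ p) xs) ℕ.≤ length (filter (T? ∘ q) xs)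
  length-filter-mono []       = z≤n
  length-filter-mono (x ∷ xs) with p x in px | q x in qx
  ... | true  | true  = s≤s (length-filter-mono xs)
  ... | true  | false = ⊥-elim (subst T qx (p⇒q (subst T (sym px) _)))
  ... | false | true  = ℕ.m≤n⇒m≤1+n (length-filter-mono xs)
  ... | false | false = length-filter-mono xs

  length-filter-mono-< : ∀ {y} xs → y ∈ xs → T (q y) → ¬ T (p y) →
                         length (filter (T? ∘ p) xs) ℕ.< length (filter (T? ∘ q) xs)
  length-filter-mono-< {y} (x ∷ xs) (here refl) qy ¬py with p y | q y
  ... | true  | _    = ⊥-elim (¬py _)
  ... | false | true = s≤s (length-filter-mono xs)
  length-filter-mono-< (x ∷ xs) (there y∈xs) qy ¬py with p x in px | q x in qx
  ... | true  | true  = s≤s (length-filter-mono-< xs y∈xs qy ¬py)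
  ... | true  | false = ⊥-elim (subst T qx (p⇒q (subst T (sym px) _)))
  ... | false | true  = ℕ.m≤n⇒m≤1+n (length-filter-mono-< xs y∈xs qy ¬py)
  ... | false | false = length-filter-mono-< xs y∈xs qy ¬py

module _ {P : Set} where

  T-does⁺ : (P? : Dec P) → P → T (does P?)
  T-does⁺ (yes _) p = _
  T-does⁺ (no ¬p) p = ¬p p

  T-does⁻ : (P? : Dec P) → T (does P?) → P
  T-does⁻ (yes p) _ = p

  T-not-does⁻ : (P? : Dec P) → T (not (does P?)) → ¬ P
  T-not-does⁻ (no ¬p) _ = ¬p

-- A sum over a subset of Fin m is a sum over all of Fin m of terms `when b x`,
-- so that restricting, splitting and exchanging sums are pointwise Boolean facts.
module IndicatorSums {A : Set} {_+_ _*_ : A → A → A} { -_ : A → A} {0# 1# : A}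
                     (isCommutativeRing : IsCommutativeRing _≡_ _+_ _*_ -_ 0# 1#) where

  ring : CommutativeRing _ _
  ring = record { isCommutativeRing = isCommutativeRing }

  open CommutativeRing ring using (+-identityˡ; +-identityʳ; *-identityˡ; zeroˡ; zeroʳ; semiring)
  open import Algebra.Properties.Semiring.Sum semiring public
    using (sum; ∑-distrib-+; ∑-comm; *-distribˡ-sum; *-distribʳ-sum; sum-cong-≗; sum-replicate-zero)

  when : Bool → A → A
  when b x = if b then x else 0#

  when-and : ∀ a b x → when (a and b) x ≡ when a (when b x)
  when-and true  b x = refl
  when-and false b x = refl

  when-comm : ∀ a b x → when a (when b x) ≡ when b (when a x)
  when-comm true  true  x = refl
  when-comm true  false x = refl
  when-comm false true  x = refl
  when-comm false false x = refl

  when-⇔ : ∀ {a b} x → T a ⇔ T b → when a x ≡ when b x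
  when-⇔ {false} {false} x a⇔b = refl
  when-⇔ {false} {true}  x a⇔b = ⊥-elim (Equivalence.from a⇔b _)
  when-⇔ {true}  {false} x a⇔b = ⊥-elim (Equivalence.to a⇔b _)
  when-⇔ {true}  {true}  x a⇔b = refl

  when-cong : ∀ b {x y} → (T b → x ≡ y) → when b x ≡ when b y
  when-cong true  x≡y = x≡y _
  when-cong false x≡y = refl

  when-true : ∀ {b} x → T b → when b x ≡ x
  when-true {true} x _ = refl

  when-false : ∀ {b} x → ¬ T b → when b x ≡ 0#
  when-false {true}  x ¬b = ⊥-elim (¬b _)
  when-false {false} x ¬b = refl

  when-split : ∀ a b x → when a x ≡ when (a and not b) x + when (a and b) x
  when-split true  true  x = sym (+-identityˡ x)
  when-split true  false x = sym (+-identityʳ x)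
  when-split false b     x = sym (+-identityˡ 0#)

  when-*ˡ : ∀ b x y → y * when b x ≡ when b (y * x)
  when-*ˡ true  x y = refl
  when-*ˡ false x y = zeroʳ y

  when-*ʳ : ∀ b x y → when b x * y ≡ when b (x * y)
  when-*ʳ true  x y = refl
  when-*ʳ false x y = zeroˡ y

  when-1-* : ∀ b x → when b 1# * x ≡ when b x
  when-1-* b x = trans (when-*ʳ b 1# x) (when-cong b (λ _ → *-identityˡ x))

  when-sum : ∀ {m} b (g : Fin m → A) → when b (sum g) ≡ sum (λ i → when b (g i))
  when-sum         true  g = refl
  when-sum {m = m} false g = sym (sum-replicate-zero m)

  sum-when-≟ : ∀ {m} (j : Fin m) (g : Fin m → A) → sum (λ i → when (does (i ≟ᶠ j)) (g i)) ≡ g j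
  sum-when-≟ {suc m} zero    g = trans (cong (g zero +_) (sum-replicate-zero m)) (+-identityʳ _)
  sum-when-≟ {suc m} (suc j) g = trans (+-identityˡ _) (sum-when-≟ j (g ∘ suc))

  sum-when-≟′ : ∀ {m} (j : Fin m) (g : Fin m → A) → sum (λ i → when (does (j ≟ᶠ i)) (g i)) ≡ g j
  sum-when-≟′ {suc m} zero    g = trans (cong (g zero +_) (sum-replicate-zero m)) (+-identityʳ _)
  sum-when-≟′ {suc m} (suc j) g = trans (+-identityˡ _) (sum-when-≟′ j (g ∘ suc))

  sum-when-interchange :
    ∀ {m k} (a : Fin m → Bool) (b : Fin m → Fin k → Bool)
            (c : Fin k → Bool) (d : Fin m → Fin k → Bool) →
    (∀ {i j} → T (a i) × T (b i j) → T (c j) × T (d i j)) →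
    (∀ {i j} → T (c j) × T (d i j) → T (a i) × T (b i j)) →
    (h : Fin m → Fin k → A) →
    sum (λ i → when (a i) (sum (λ j → when (b i j) (h i j)))) ≡
    sum (λ j → when (c j) (sum (λ i → when (d i j) (h i j))))
  sum-when-interchange a b c d ab⇒cd cd⇒ab h = begin
    sum (λ i → when (a i) (sum (λ j → when (b i j) (h i j))))
      ≡⟨ sum-cong-≗ (λ i → trans (when-sum (a i) (λ j → when (b i j) (h i j)))
                                 (sum-cong-≗ (λ j → sym (when-and (a i) (b i j) (h i j))))) ⟩
    sum (λ i → sum (λ j → when (a i and b i j) (h i j)))
      ≡⟨ sum-cong-≗ (λ i → sum-cong-≗ (λ j → when-⇔ (h i j) (mk⇔ ab→cd cd→ab))) ⟩
    sum (λ i → sum (λ j → when (c j and d i j) (h i j)))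
      ≡⟨ ∑-comm (λ i j → when (c j and d i j) (h i j)) ⟩
    sum (λ j → sum (λ i → when (c j and d i j) (h i j)))
      ≡⟨ sum-cong-≗ (λ j → trans (sum-cong-≗ (λ i → when-and (c j) (d i j) (h i j)))
                                 (sym (when-sum (c j) (λ i → when (d i j) (h i j))))) ⟩
    sum (λ j → when (c j) (sum (λ i → when (d i j) (h i j)))) ∎
    where
      open ≡-Reasoning
      ab→cd : ∀ {i j} → T (a i and b i j) → T (c j and d i j)
      ab→cd = Equivalence.from T-∧ ∘ ab⇒cd ∘ Equivalence.to T-∧
      cd→ab : ∀ {i j} → T (c j and d i j) → T (a i and b i j)
      cd→ab = Equivalence.from T-∧ ∘ cd⇒ab ∘ Equivalence.to T-∧

  sumList-filter : ∀ {m k} (p : Fin m → Bool) (g : Fin m → A) (t : Fin k → Fin m) →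
                   foldr _+_ 0# (map g (filter (T? ∘ p) (tabulate t))) ≡
                   sum (λ i → when (p (t i)) (g (t i)))
  sumList-filter {k = zero}  p g t = refl
  sumList-filter {k = suc k} p g t with p (t zero)
  ... | true  = cong (g (t zero) +_) (sumList-filter p g (t ∘ suc))
  ... | false = trans (sumList-filter p g (t ∘ suc)) (sym (+-identityˡ _))

module Intervals (ℒ : FinModLattice) where

  open FinModLattice ℒ renaming (_≤_ to _⊑_)
  open IsBoundedLattice isBoundedLattice public using (maximum; minimum; infimum)
    renaming (reflexive to ⊑-reflexive; trans to ⊑-trans; antisym to ⊑-antisym)

  ⊑-refl : ∀ {X} → X ⊑ X
  ⊑-refl = ⊑-reflexive refl

  inHalfOpen : Carrier → Carrier → Carrier → Bool
  inHalfOpen X Y Z = inInterval X Y Z and not (does (Z ≟ᶠ Y))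

  _∈[_,_] : Carrier → Carrier → Carrier → Set
  Z ∈[ X , Y ] = T (inInterval X Y Z)

  _∈[_,_⟩ : Carrier → Carrier → Carrier → Set
  Z ∈[ X , Y ⟩ = T (inHalfOpen X Y Z)

  inInterval⁺ : ∀ {X Y Z} → X ⊑ Z → Z ⊑ Y → Z ∈[ X , Y ]
  inInterval⁺ {X} {Y} {Z} X⊑Z Z⊑Y =
    Equivalence.from T-∧ (T-does⁺ (X ≤? Z) X⊑Z , T-does⁺ (Z ≤? Y) Z⊑Y)

  inInterval⁻ : ∀ {X Y Z} → Z ∈[ X , Y ] → X ⊑ Z × Z ⊑ Y
  inInterval⁻ {X} {Y} {Z} Z∈ with Equivalence.to T-∧ Z∈
  ... | X≤?Z , Z≤?Y = T-does⁻ (X ≤? Z) X≤?Z , T-does⁻ (Z ≤? Y) Z≤?Y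

  inHalfOpen⁻ : ∀ {X Y Z} → Z ∈[ X , Y ⟩ → X ⊑ Z × Z ⊑ Y × Z ≢ Y
  inHalfOpen⁻ {X} {Y} {Z} Z∈ with Equivalence.to T-∧ Z∈
  ... | Z∈[X,Y] , Z≢?Y with inInterval⁻ Z∈[X,Y]
  ...   | X⊑Z , Z⊑Y = X⊑Z , Z⊑Y , T-not-does⁻ (Z ≟ᶠ Y) Z≢?Y

  size : Carrier → Carrier → ℕ
  size X Y = length (interval X Y)

  size≤n : ∀ X Y → size X Y ℕ.≤ n
  size≤n X Y = ℕ.≤-trans (length-filter (T? ∘ inInterval X Y) (allFin n))
                         (ℕ.≤-reflexive (length-tabulate id))

  size-pos : ∀ {X Y} → X ⊑ Y → 0 ℕ.< size X Y
  size-pos {X} {Y} X⊑Y =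
    filter-some (T? ∘ inInterval X Y) (Any.map (λ { refl → inInterval⁺ ⊑-refl X⊑Y }) (∈-allFin X))

  size-< : ∀ {X Y W} → X ⊑ W → W ⊑ Y → W ≢ Y → size X W ℕ.< size X Y
  size-< {X} {Y} {W} X⊑W W⊑Y W≢Y =
    length-filter-mono-< (inInterval X W) (inInterval X Y) [X,W]⊆[X,Y]
      (allFin n) (∈-allFin Y) (inInterval⁺ (⊑-trans X⊑W W⊑Y) ⊑-refl) Y∉[X,W]
    where
      [X,W]⊆[X,Y] : ∀ {Z} → Z ∈[ X , W ] → Z ∈[ X , Y ]
      [X,W]⊆[X,Y] Z∈ with inInterval⁻ Z∈
      ... | X⊑Z , Z⊑W = inInterval⁺ X⊑Z (⊑-trans Z⊑W W⊑Y)
      Y∉[X,W] : ¬ Y ∈[ X , W ]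
      Y∉[X,W] Y∈ with inInterval⁻ Y∈
      ... | _ , Y⊑W = W≢Y (⊑-antisym W⊑Y Y⊑W)

  size-shrinks : ∀ {k X Y W} → size X Y ℕ.≤ suc k → X ⊑ W → W ⊑ Y → W ≢ Y → size X W ℕ.≤ k
  size-shrinks size≤1+k X⊑W W⊑Y W≢Y = ℕ.≤-pred (ℕ.≤-trans (size-< X⊑W W⊑Y W≢Y) size≤1+k)

module IntervalSums (ℒ : FinModLattice)
                    {A : Set} {_+_ _*_ : A → A → A} { -_ : A → A} {0# 1# : A}
                    (isCommutativeRing : IsCommutativeRing _≡_ _+_ _*_ -_ 0# 1#) where

  open FinModLattice ℒ renaming (_≤_ to _⊑_)
  open Intervals ℒ
  open IndicatorSums isCommutativeRing public

  ∑[_,_] : Carrier → Carrier → (Carrier → A) → A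
  ∑[ X , Y ] g = sum (λ Z → when (inInterval X Y Z) (g Z))

  ∑[_,_⟩ : Carrier → Carrier → (Carrier → A) → A
  ∑[ X , Y ⟩ g = sum (λ Z → when (inHalfOpen X Y Z) (g Z))

  δ : Carrier → Carrier → A
  δ X Y = when (does (X ≟ᶠ Y)) 1#

  sumList-interval : ∀ X Y g → foldr _+_ 0# (map g (interval X Y)) ≡ ∑[ X , Y ] g
  sumList-interval X Y g = sumList-filter (inInterval X Y) g id

  sumList-halfOpen : ∀ X Y g → foldr _+_ 0# (map g (halfOpen X Y)) ≡ ∑[ X , Y ⟩ g
  sumList-halfOpen X Y g = sumList-filter (inHalfOpen X Y) g id

  ∑[]-cong : ∀ {X Y g h} → (∀ {Z} → X ⊑ Z → Z ⊑ Y → g Z ≡ h Z) →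
             ∑[ X , Y ] g ≡ ∑[ X , Y ] h
  ∑[]-cong {X} {Y} g≡h = sum-cong-≗ λ Z → when-cong (inInterval X Y Z) λ Z∈ →
    let X⊑Z , Z⊑Y = inInterval⁻ Z∈ in g≡h X⊑Z Z⊑Y

  ∑[⟩-cong : ∀ {X Y g h} → (∀ {Z} → X ⊑ Z → Z ⊑ Y → Z ≢ Y → g Z ≡ h Z) →
             ∑[ X , Y ⟩ g ≡ ∑[ X , Y ⟩ h
  ∑[⟩-cong {X} {Y} g≡h = sum-cong-≗ λ Z → when-cong (inHalfOpen X Y Z) λ Z∈ →
    let X⊑Z , Z⊑Y , Z≢Y = inHalfOpen⁻ Z∈ in g≡h X⊑Z Z⊑Y Z≢Y

  ∑[]-*ˡ : ∀ X Y c (g : Carrier → A) → c * ∑[ X , Y ] g ≡ ∑[ X , Y ] (λ Z → c * g Z)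
  ∑[]-*ˡ X Y c g = trans (*-distribˡ-sum c (λ Z → when (inInterval X Y Z) (g Z)))
                         (sum-cong-≗ (λ Z → when-*ˡ (inInterval X Y Z) (g Z) c))

  ∑[]-*ʳ : ∀ X Y c (g : Carrier → A) → ∑[ X , Y ] g * c ≡ ∑[ X , Y ] (λ Z → g Z * c)
  ∑[]-*ʳ X Y c g = trans (*-distribʳ-sum c (λ Z → when (inInterval X Y Z) (g Z)))
                         (sum-cong-≗ (λ Z → when-*ʳ (inInterval X Y Z) (g Z) c))

  ∑[⟩-empty : ∀ X (g : Carrier → A) → ∑[ X , X ⟩ g ≡ 0#
  ∑[⟩-empty X g = trans (sum-cong-≗ λ Z → when-false (g Z) Z∉[X,X⟩) (sum-replicate-zero n)
    where
      Z∉[X,X⟩ : ∀ {Z} → ¬ Z ∈[ X , X ⟩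
      Z∉[X,X⟩ Z∈ with inHalfOpen⁻ Z∈
      ... | X⊑Z , Z⊑X , Z≢X = Z≢X (⊑-antisym Z⊑X X⊑Z)

  ∑[]-split-top : ∀ {X Y} (g : Carrier → A) → X ⊑ Y → ∑[ X , Y ] g ≡ ∑[ X , Y ⟩ g + g Y
  ∑[]-split-top {X} {Y} g X⊑Y = begin
    ∑[ X , Y ] g
      ≡⟨ sum-cong-≗ (λ Z → when-split (inInterval X Y Z) (does (Z ≟ᶠ Y)) (g Z)) ⟩
    sum (λ Z → when (inHalfOpen X Y Z) (g Z) + when (inInterval X Y Z and does (Z ≟ᶠ Y)) (g Z))
      ≡⟨ ∑-distrib-+ (λ Z → when (inHalfOpen X Y Z) (g Z)) _ ⟩
    ∑[ X , Y ⟩ g + sum (λ Z → when (inInterval X Y Z and does (Z ≟ᶠ Y)) (g Z))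
      ≡⟨ cong (∑[ X , Y ⟩ g +_) (sum-cong-≗ λ Z →
           trans (when-and (inInterval X Y Z) _ (g Z)) (when-comm (inInterval X Y Z) _ (g Z))) ⟩
    ∑[ X , Y ⟩ g + sum (λ Z → when (does (Z ≟ᶠ Y)) (when (inInterval X Y Z) (g Z)))
      ≡⟨ cong (∑[ X , Y ⟩ g +_) (sum-when-≟ Y (λ Z → when (inInterval X Y Z) (g Z))) ⟩
    ∑[ X , Y ⟩ g + when (inInterval X Y Y) (g Y)
      ≡⟨ cong (∑[ X , Y ⟩ g +_) (when-true (g Y) (inInterval⁺ X⊑Y ⊑-refl)) ⟩
    ∑[ X , Y ⟩ g + g Y ∎
    where open ≡-Reasoning

  ∑[]-δ-bottom : ∀ {X Y} (g : Carrier → A) → X ⊑ Y → ∑[ X , Y ] (λ Z → δ X Z * g Z) ≡ g X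
  ∑[]-δ-bottom {X} {Y} g X⊑Y = begin
    ∑[ X , Y ] (λ Z → δ X Z * g Z)
      ≡⟨ sum-cong-≗ (λ Z → trans (cong (when (inInterval X Y Z)) (when-1-* (does (X ≟ᶠ Z)) (g Z)))
                                 (when-comm (inInterval X Y Z) _ (g Z))) ⟩
    sum (λ Z → when (does (X ≟ᶠ Z)) (when (inInterval X Y Z) (g Z)))
      ≡⟨ sum-when-≟′ X (λ Z → when (inInterval X Y Z) (g Z)) ⟩
    when (inInterval X Y X) (g X)
      ≡⟨ when-true (g X) (inInterval⁺ ⊑-refl X⊑Y) ⟩
    g X ∎
    where open ≡-Reasoning

  ∑[]-δ-top : ∀ {X Y} (g : Carrier → A) → X ⊑ Y → ∑[ X , Y ] (λ Z → δ Z Y * g Z) ≡ g Y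
  ∑[]-δ-top {X} {Y} g X⊑Y = begin
    ∑[ X , Y ] (λ Z → δ Z Y * g Z)
      ≡⟨ sum-cong-≗ (λ Z → trans (cong (when (inInterval X Y Z)) (when-1-* (does (Z ≟ᶠ Y)) (g Z)))
                                 (when-comm (inInterval X Y Z) _ (g Z))) ⟩
    sum (λ Z → when (does (Z ≟ᶠ Y)) (when (inInterval X Y Z) (g Z)))
      ≡⟨ sum-when-≟ Y (λ Z → when (inInterval X Y Z) (g Z)) ⟩
    when (inInterval X Y Y) (g Y)
      ≡⟨ when-true (g Y) (inInterval⁺ X⊑Y ⊑-refl) ⟩
    g Y ∎
    where open ≡-Reasoning

  ∑[]-interchange : ∀ X Y (h : Carrier → Carrier → A) →
                    ∑[ X , Y ] (λ Z → ∑[ Z , Y ] (h Z)) ≡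
                    ∑[ X , Y ] (λ W → ∑[ X , W ] (λ Z → h Z W))
  ∑[]-interchange X Y = sum-when-interchange _ _ _ _ to from
    where
      to : ∀ {Z W} → Z ∈[ X , Y ] × W ∈[ Z , Y ] → W ∈[ X , Y ] × Z ∈[ X , W ]
      to (Z∈ , W∈) with inInterval⁻ Z∈ | inInterval⁻ W∈
      ... | X⊑Z , _ | Z⊑W , W⊑Y = inInterval⁺ (⊑-trans X⊑Z Z⊑W) W⊑Y , inInterval⁺ X⊑Z Z⊑W
      from : ∀ {Z W} → W ∈[ X , Y ] × Z ∈[ X , W ] → Z ∈[ X , Y ] × W ∈[ Z , Y ]
      from (W∈ , Z∈) with inInterval⁻ W∈ | inInterval⁻ Z∈
      ... | _ , W⊑Y | X⊑Z , Z⊑W = inInterval⁺ X⊑Z (⊑-trans Z⊑W W⊑Y) , inInterval⁺ Z⊑W W⊑Y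

  ∑[]-interchange-meet : ∀ X U Y (h : Carrier → Carrier → A) →
                         ∑[ X , U ] (λ A → ∑[ A , Y ] (h A)) ≡
                         ∑[ X , Y ] (λ B → ∑[ X , B ∧ U ] (λ A → h A B))
  ∑[]-interchange-meet X U Y = sum-when-interchange _ _ _ _ to from
    where
      to : ∀ {A B} → A ∈[ X , U ] × B ∈[ A , Y ] → B ∈[ X , Y ] × A ∈[ X , B ∧ U ]
      to {A} {B} (A∈ , B∈) with inInterval⁻ A∈ | inInterval⁻ B∈ | infimum B U
      ... | X⊑A , A⊑U | A⊑B , B⊑Y | _ , _ , glb =
        inInterval⁺ (⊑-trans X⊑A A⊑B) B⊑Y , inInterval⁺ X⊑A (glb A A⊑B A⊑U)
      from : ∀ {A B} → B ∈[ X , Y ] × A ∈[ X , B ∧ U ] → A ∈[ X , U ] × B ∈[ A , Y ]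
      from {A} {B} (B∈ , A∈) with inInterval⁻ B∈ | inInterval⁻ A∈ | infimum B U
      ... | _ , B⊑Y | X⊑A , A⊑B∧U | B∧U⊑B , B∧U⊑U , _ =
        inInterval⁺ X⊑A (⊑-trans A⊑B∧U B∧U⊑U) , inInterval⁺ (⊑-trans A⊑B∧U B∧U⊑B) B⊑Y

module Möbius (ℒ : FinModLattice) where

  open FinModLattice ℒ renaming (_≤_ to _⊑_)
  open Intervals ℒ
  open IntervalSums ℒ ℤ.+-*-isCommutativeRing
  open import Data.Integer using (_+_; -_)
  open import Algebra.Properties.Group (AbelianGroup.group ℤ.+-0-abelianGroup) using (∙-cancelˡ)

  möbiusFuel-stable : ∀ k X Y → size X Y ℕ.≤ k → möbiusFuel k X Y ≡ möbiusFuel (suc k) X Y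
  möbiusFuel-stable k X Y size≤k with X ≟ᶠ Y | X ≤? Y
  ... | yes _  | _       = refl
  ... | no _   | no _    = refl
  ... | no X≢Y | yes X⊑Y with k
  ...   | zero  = ⊥-elim (ℕ.<⇒≱ (size-pos X⊑Y) size≤k)
  ...   | suc k = cong -_ (begin
    foldr _+_ 0ℤ (map (möbiusFuel k X) (halfOpen X Y))       ≡⟨ sumList-halfOpen X Y _ ⟩
    ∑[ X , Y ⟩ (möbiusFuel k X)                              ≡⟨ ∑[⟩-cong stable ⟩
    ∑[ X , Y ⟩ (möbiusFuel (suc k) X)                        ≡⟨ sumList-halfOpen X Y _ ⟨
    foldr _+_ 0ℤ (map (möbiusFuel (suc k) X) (halfOpen X Y)) ∎)
    where
      open ≡-Reasoning
      stable : ∀ {Z} → X ⊑ Z → Z ⊑ Y → Z ≢ Y → möbiusFuel k X Z ≡ möbiusFuel (suc k) X Z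
      stable X⊑Z Z⊑Y Z≢Y = möbiusFuel-stable k X _ (size-shrinks size≤k X⊑Z Z⊑Y Z≢Y)

  möbiusFuel-unfold : ∀ k {X Y} → size X Y ℕ.≤ k → X ⊑ Y → X ≢ Y →
                      möbiusFuel k X Y ≡ - ∑[ X , Y ⟩ (möbiusFuel k X)
  möbiusFuel-unfold zero    size≤0 X⊑Y X≢Y = ⊥-elim (ℕ.<⇒≱ (size-pos X⊑Y) size≤0)
  möbiusFuel-unfold (suc k) {X} {Y} size≤k X⊑Y X≢Y with X ≟ᶠ Y | X ≤? Y
  ... | yes X≡Y | _      = ⊥-elim (X≢Y X≡Y)
  ... | no _    | no X⋢Y = ⊥-elim (X⋢Y X⊑Y)
  ... | no _    | yes _  = cong -_ (trans (sumList-halfOpen X Y _) (∑[⟩-cong stable))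
    where
      stable : ∀ {Z} → X ⊑ Z → Z ⊑ Y → Z ≢ Y → möbiusFuel k X Z ≡ möbiusFuel (suc k) X Z
      stable X⊑Z Z⊑Y Z≢Y = möbiusFuel-stable k X _ (size-shrinks size≤k X⊑Z Z⊑Y Z≢Y)

  μ-refl : ∀ X → μ X X ≡ 1ℤ
  μ-refl X with X ≟ᶠ X
  ... | yes _  = refl
  ... | no X≢X = ⊥-elim (X≢X refl)

  μ-unfold : ∀ {X Y} → X ⊑ Y → X ≢ Y → μ X Y ≡ - ∑[ X , Y ⟩ (μ X)
  μ-unfold {X} {Y} = möbiusFuel-unfold n (size≤n X Y)

  ∑μ-bottom-refl : ∀ X → ∑[ X , X ] (μ X) ≡ 1ℤ
  ∑μ-bottom-refl X = begin
    ∑[ X , X ] (μ X)         ≡⟨ ∑[]-split-top (μ X) ⊑-refl ⟩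
    ∑[ X , X ⟩ (μ X) + μ X X ≡⟨ cong₂ _+_ (∑[⟩-empty X (μ X)) (μ-refl X) ⟩
    1ℤ                       ∎
    where open ≡-Reasoning

  ∑μ-bottom-≢ : ∀ {X Y} → X ⊑ Y → X ≢ Y → ∑[ X , Y ] (μ X) ≡ 0ℤ
  ∑μ-bottom-≢ {X} {Y} X⊑Y X≢Y = begin
    ∑[ X , Y ] (μ X)                      ≡⟨ ∑[]-split-top (μ X) X⊑Y ⟩
    ∑[ X , Y ⟩ (μ X) + μ X Y              ≡⟨ cong (∑[ X , Y ⟩ (μ X) +_) (μ-unfold X⊑Y X≢Y) ⟩
    ∑[ X , Y ⟩ (μ X) + - ∑[ X , Y ⟩ (μ X) ≡⟨ ℤ.+-inverseʳ (∑[ X , Y ⟩ (μ X)) ⟩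
    0ℤ                                    ∎
    where open ≡-Reasoning

  ∑μ-bottom : ∀ {X Y} → X ⊑ Y → ∑[ X , Y ] (μ X) ≡ δ X Y
  ∑μ-bottom {X} {Y} X⊑Y with X ≟ᶠ Y
  ... | yes refl = ∑μ-bottom-refl X
  ... | no X≢Y   = ∑μ-bottom-≢ X⊑Y X≢Y

  -- Double counting Σ_{X ≤ Z ≤ W ≤ Y} μ(Z,W): summing over W first (using the induction
  -- hypothesis for W < Y) and over Z first (using ∑μ-bottom) gives the two sides.
  ∑μ-top-bounded : ∀ k {X Y} → size X Y ℕ.≤ k → X ⊑ Y → ∑[ X , Y ] (λ Z → μ Z Y) ≡ δ X Y
  ∑μ-top-bounded zero    size≤0 X⊑Y = ⊥-elim (ℕ.<⇒≱ (size-pos X⊑Y) size≤0)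
  ∑μ-top-bounded (suc k) {X} {Y} size≤k X⊑Y = ∙-cancelˡ (∑[ X , Y ⟩ (δ X)) _ _ (begin
    ∑[ X , Y ⟩ (δ X) + ∑[ X , Y ] (λ Z → μ Z Y)
      ≡⟨ cong (_+ ∑[ X , Y ] (λ Z → μ Z Y)) (∑[⟩-cong IH) ⟨
    ∑[ X , Y ⟩ (λ W → ∑[ X , W ] (λ Z → μ Z W)) + ∑[ X , Y ] (λ Z → μ Z Y)
      ≡⟨ ∑[]-split-top (λ W → ∑[ X , W ] (λ Z → μ Z W)) X⊑Y ⟨
    ∑[ X , Y ] (λ W → ∑[ X , W ] (λ Z → μ Z W))
      ≡⟨ ∑[]-interchange X Y μ ⟨
    ∑[ X , Y ] (λ Z → ∑[ Z , Y ] (μ Z))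
      ≡⟨ ∑[]-cong (λ _ Z⊑Y → ∑μ-bottom Z⊑Y) ⟩
    ∑[ X , Y ] (λ Z → δ Z Y)
      ≡⟨ trans (∑[]-cong (λ _ _ → sym (ℤ.*-identityʳ _))) (∑[]-δ-top (λ _ → 1ℤ) X⊑Y) ⟩
    1ℤ
      ≡⟨ trans (∑[]-cong (λ _ _ → sym (ℤ.*-identityʳ _))) (∑[]-δ-bottom (λ _ → 1ℤ) X⊑Y) ⟨
    ∑[ X , Y ] (δ X)
      ≡⟨ ∑[]-split-top (δ X) X⊑Y ⟩
    ∑[ X , Y ⟩ (δ X) + δ X Y ∎)
    where
      open ≡-Reasoning
      IH : ∀ {W} → X ⊑ W → W ⊑ Y → W ≢ Y → ∑[ X , W ] (λ Z → μ Z W) ≡ δ X W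
      IH X⊑W W⊑Y W≢Y = ∑μ-top-bounded k (size-shrinks size≤k X⊑W W⊑Y W≢Y) X⊑W

  ∑μ-top : ∀ {X Y} → X ⊑ Y → ∑[ X , Y ] (λ Z → μ Z Y) ≡ δ X Y
  ∑μ-top {X} {Y} = ∑μ-top-bounded (size X Y) ℕ.≤-refl

module IntegerEmbedding (F : RealClosedField) where

  open RealClosedField F
  open IndicatorSums isCommutativeRing using (ring; sum; when)
  private module ℤΣ = IndicatorSums ℤ.+-*-isCommutativeRing
  open CommutativeRing ring
    using (+-assoc; +-identityˡ; +-identityʳ; -‿inverseˡ; +-group; +-commutativeSemigroup)
  open import Algebra.Properties.Group +-group using (∙-cancelʳ)
  open import Algebra.Properties.CommutativeSemigroup +-commutativeSemigroup
    using (interchange; x∙yz≈y∙xz)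

  fromℕ-+ : ∀ a b → fromℕ (a ℕ.+ b) ≡ fromℕ a + fromℕ b
  fromℕ-+ zero    b = sym (+-identityˡ (fromℕ b))
  fromℕ-+ (suc a) b = trans (cong (1# +_) (fromℕ-+ a b)) (sym (+-assoc 1# (fromℕ a) (fromℕ b)))

  fromℤ-⊖ : ∀ a b → fromℤ (a ⊖ b) + fromℕ b ≡ fromℕ a
  fromℤ-⊖ a       zero    = +-identityʳ (fromℕ a)
  fromℤ-⊖ zero    (suc b) = -‿inverseˡ (fromℕ (suc b))
  fromℤ-⊖ (suc a) (suc b) = begin
    fromℤ (suc a ⊖ suc b) + (1# + fromℕ b)
      ≡⟨ cong (λ x → fromℤ x + (1# + fromℕ b)) (ℤ.[1+m]⊖[1+n]≡m⊖n a b) ⟩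
    fromℤ (a ⊖ b) + (1# + fromℕ b)
      ≡⟨ x∙yz≈y∙xz (fromℤ (a ⊖ b)) 1# (fromℕ b) ⟩
    1# + (fromℤ (a ⊖ b) + fromℕ b)
      ≡⟨ cong (1# +_) (fromℤ-⊖ a b) ⟩
    1# + fromℕ a ∎
    where open ≡-Reasoning

  fromℤ-+-⊖ : ∀ x c d → fromℤ (x ℤ.+ (c ⊖ d)) ≡ fromℤ x + fromℤ (c ⊖ d)
  fromℤ-+-⊖ (ℤ.+ a) c d = ∙-cancelʳ (fromℕ d) _ _ (begin
    fromℤ (ℤ.+ a ℤ.+ (c ⊖ d)) + fromℕ d   ≡⟨ cong (λ x → fromℤ x + fromℕ d) (ℤ.distribʳ-⊖-+-pos a c d) ⟩
    fromℤ (a ℕ.+ c ⊖ d) + fromℕ d         ≡⟨ fromℤ-⊖ (a ℕ.+ c) d ⟩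
    fromℕ (a ℕ.+ c)                       ≡⟨ fromℕ-+ a c ⟩
    fromℕ a + fromℕ c                     ≡⟨ cong (fromℕ a +_) (fromℤ-⊖ c d) ⟨
    fromℕ a + (fromℤ (c ⊖ d) + fromℕ d)   ≡⟨ +-assoc (fromℕ a) (fromℤ (c ⊖ d)) (fromℕ d) ⟨
    (fromℕ a + fromℤ (c ⊖ d)) + fromℕ d   ∎)
    where open ≡-Reasoning
  fromℤ-+-⊖ -[1+ a ] c d = ∙-cancelʳ (fromℕ (suc a ℕ.+ d)) _ _ (begin
    fromℤ (-[1+ a ] ℤ.+ (c ⊖ d)) + fromℕ (suc a ℕ.+ d)
      ≡⟨ cong (λ x → fromℤ x + fromℕ (suc a ℕ.+ d)) (ℤ.distribʳ-⊖-+-neg a c d) ⟩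
    fromℤ (c ⊖ (suc a ℕ.+ d)) + fromℕ (suc a ℕ.+ d)
      ≡⟨ fromℤ-⊖ c (suc a ℕ.+ d) ⟩
    fromℕ c
      ≡⟨ +-identityˡ (fromℕ c) ⟨
    0# + fromℕ c
      ≡⟨ cong₂ _+_ (fromℤ-⊖ 0 (suc a)) (fromℤ-⊖ c d) ⟨
    (fromℤ -[1+ a ] + fromℕ (suc a)) + (fromℤ (c ⊖ d) + fromℕ d)
      ≡⟨ interchange (fromℤ -[1+ a ]) (fromℕ (suc a)) (fromℤ (c ⊖ d)) (fromℕ d) ⟩
    (fromℤ -[1+ a ] + fromℤ (c ⊖ d)) + (fromℕ (suc a) + fromℕ d)
      ≡⟨ cong ((fromℤ -[1+ a ] + fromℤ (c ⊖ d)) +_) (fromℕ-+ (suc a) d) ⟨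
    (fromℤ -[1+ a ] + fromℤ (c ⊖ d)) + fromℕ (suc a ℕ.+ d) ∎)
    where open ≡-Reasoning

  -- ℤ.+ c and -[1+ d ] are definitionally c ⊖ 0 and 0 ⊖ suc d.
  fromℤ-+ : ∀ x y → fromℤ (x ℤ.+ y) ≡ fromℤ x + fromℤ y
  fromℤ-+ x (ℤ.+ c)  = fromℤ-+-⊖ x c 0
  fromℤ-+ x -[1+ d ] = fromℤ-+-⊖ x 0 (suc d)

  fromℤ-1 : fromℤ 1ℤ ≡ 1#
  fromℤ-1 = +-identityʳ 1#

  fromℤ-when : ∀ b x → fromℤ (ℤΣ.when b x) ≡ when b (fromℤ x)
  fromℤ-when true  x = refl
  fromℤ-when false x = refl

  fromℤ-sum : ∀ {m} (g : Fin m → ℤ) → fromℤ (ℤΣ.sum g) ≡ sum (fromℤ ∘ g)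
  fromℤ-sum {zero}  g = refl
  fromℤ-sum {suc m} g =
    trans (fromℤ-+ (g zero) (ℤΣ.sum (g ∘ suc))) (cong (fromℤ (g zero) +_) (fromℤ-sum (g ∘ suc)))

module OrderedSums (F : RealClosedField) where

  open RealClosedField F
  open IndicatorSums isCommutativeRing using (ring; sum; when)
  open CommutativeRing ring using (+-comm; +-identityˡ; +-identityʳ; zeroˡ)
  open IsStrictTotalOrder isStrictTotalOrder using (irrefl; <-respʳ-≈) renaming (trans to <-trans)
  import Relation.Binary.Construct.StrictToNonStrict _≡_ _<_ as NonStrict

  ≤-trans : ∀ {x y z} → x ≤ y → y ≤ z → x ≤ z
  ≤-trans = NonStrict.trans isEquivalence (resp₂ _<_) <-trans

  <-≤-trans : ∀ {x y z} → x < y → y ≤ z → x < z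
  <-≤-trans = NonStrict.<-≤-trans <-trans <-respʳ-≈

  +-monoˡ-≤ : ∀ {x y} z → x ≤ y → (x + z) ≤ (y + z)
  +-monoˡ-≤ z (inj₁ x<y)  = inj₁ (+-mono-< z x<y)
  +-monoˡ-≤ z (inj₂ refl) = inj₂ refl

  +-mono-≤ : ∀ {x y u v} → x ≤ y → u ≤ v → (x + u) ≤ (y + v)
  +-mono-≤ {x} {y} {u} {v} x≤y u≤v =
    ≤-trans (+-monoˡ-≤ u x≤y) (subst₂ _≤_ (+-comm u y) (+-comm v y) (+-monoˡ-≤ y u≤v))

  when-nonneg : ∀ b {x} → 0# ≤ x → 0# ≤ when b x
  when-nonneg true  0≤x = 0≤x
  when-nonneg false 0≤x = inj₂ refl

  sum-nonneg : ∀ {m} (g : Fin m → Carrier) → (∀ i → 0# ≤ g i) → 0# ≤ sum g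
  sum-nonneg {zero}  g 0≤g = inj₂ refl
  sum-nonneg {suc m} g 0≤g =
    subst (_≤ sum g) (+-identityʳ 0#) (+-mono-≤ (0≤g zero) (sum-nonneg (g ∘ suc) (0≤g ∘ suc)))

  term≤sum : ∀ {m} (g : Fin m → Carrier) → (∀ i → 0# ≤ g i) → ∀ j → g j ≤ sum g
  term≤sum g 0≤g zero =
    subst (_≤ sum g) (+-identityʳ (g zero)) (+-mono-≤ (inj₂ refl) (sum-nonneg (g ∘ suc) (0≤g ∘ suc)))
  term≤sum g 0≤g (suc j) =
    subst (_≤ sum g) (+-identityˡ (g (suc j)))
          (+-mono-≤ (0≤g zero) (term≤sum (g ∘ suc) (0≤g ∘ suc) j))

  nonneg-factor-pos : ∀ {x y} → 0# ≤ x → 0# < x * y → 0# < x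
  nonneg-factor-pos         (inj₁ 0<x)  _     = 0<x
  nonneg-factor-pos {y = y} (inj₂ refl) 0<0*y = ⊥-elim (irrefl refl (subst (0# <_) (zeroˡ y) 0<0*y))

module CharacteristicPolynomial (F : RealClosedField) (W : WeightedLattice)
                                (θ : RealClosedField.Carrier F) where

  open RealClosedField F
  open WeightedLattice W
  open FinModLattice lattice using (𝟎; 𝟏; _∧_; μ; inInterval) renaming (_≤_ to _⊑_; Carrier to L)
  open Intervals lattice
  open IntervalSums lattice isCommutativeRing
  module ℤΣ = IntervalSums lattice ℤ.+-*-isCommutativeRing
  open Möbius lattice
  open IntegerEmbedding F
  open OrderedSums F
  open CommutativeRing ring using (*-assoc; *-identityˡ)

  μF : L → L → Carrier
  μF X Y = fromℤ (μ X Y)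

  fromℤ-∑[] : ∀ X Y (g : L → ℤ) → fromℤ (ℤΣ.∑[ X , Y ] g) ≡ ∑[ X , Y ] (fromℤ ∘ g)
  fromℤ-∑[] X Y g = trans (fromℤ-sum (λ Z → ℤΣ.when (inInterval X Y Z) (g Z)))
                          (sum-cong-≗ (λ Z → fromℤ-when (inInterval X Y Z) (g Z)))

  fromℤ-δ : ∀ X Y → fromℤ (ℤΣ.δ X Y) ≡ δ X Y
  fromℤ-δ X Y = trans (fromℤ-when (does (X ≟ᶠ Y)) 1ℤ) (cong (when (does (X ≟ᶠ Y))) fromℤ-1)

  ∑μF-bottom : ∀ {X Y} → X ⊑ Y → ∑[ X , Y ] (μF X) ≡ δ X Y
  ∑μF-bottom {X} {Y} X⊑Y =
    trans (sym (fromℤ-∑[] X Y (μ X))) (trans (cong fromℤ (∑μ-bottom X⊑Y)) (fromℤ-δ X Y))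

  ∑μF-top : ∀ {X Y} → X ⊑ Y → ∑[ X , Y ] (λ Z → μF Z Y) ≡ δ X Y
  ∑μF-top {X} {Y} X⊑Y =
    trans (sym (fromℤ-∑[] X Y (λ Z → μ Z Y))) (trans (cong fromℤ (∑μ-top X⊑Y)) (fromℤ-δ X Y))

  ^-+ : ∀ x a b → x ^ a * x ^ b ≡ x ^ (a ℕ.+ b)
  ^-+ x zero    b = *-identityˡ (x ^ b)
  ^-+ x (suc a) b = trans (*-assoc x (x ^ a) (x ^ b)) (cong (x *_) (^-+ x a b))

  ∸-telescope : ∀ {x y z} → x ℕ.≤ y → y ℕ.≤ z → (y ∸ x) ℕ.+ (z ∸ y) ≡ z ∸ x
  ∸-telescope {x} {y} {z} x≤y y≤z = begin
    (y ∸ x) ℕ.+ (z ∸ y) ≡⟨ ℕ.+-comm (y ∸ x) (z ∸ y) ⟩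
    (z ∸ y) ℕ.+ (y ∸ x) ≡⟨ ℕ.+-∸-assoc (z ∸ y) x≤y ⟨
    (z ∸ y) ℕ.+ y ∸ x   ≡⟨ cong (_∸ x) (ℕ.m∸n+n≡m y≤z) ⟩
    z ∸ x               ∎
    where open ≡-Reasoning

  θ^f : L → L → Carrier
  θ^f X Y = θ ^ (f Y ∸ f X)

  θ^f-trans : ∀ {X Y Z} → X ⊑ Y → Y ⊑ Z → θ^f X Y * θ^f Y Z ≡ θ^f X Z
  θ^f-trans {X} {Y} {Z} X⊑Y Y⊑Z =
    trans (^-+ θ (f Y ∸ f X) (f Z ∸ f Y)) (cong (θ ^_) (∸-telescope (f-mono X⊑Y) (f-mono Y⊑Z)))

  χ : L → L → Carrier
  χ X Y = ∑[ X , Y ] (λ A → μF X A * θ^f A Y)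

  charPoly≡χ : ∀ X Y → charPoly F W X Y θ ≡ χ X Y
  charPoly≡χ X Y = sumList-interval X Y (λ A → μF X A * θ^f A Y)

  ∑χ-upper : ∀ {X Y} → X ⊑ Y → ∑[ X , Y ] (λ B → χ B Y) ≡ θ^f X Y
  ∑χ-upper {X} {Y} X⊑Y = begin
    ∑[ X , Y ] (λ B → ∑[ B , Y ] (λ C → μF B C * θ^f C Y))
      ≡⟨ ∑[]-interchange X Y (λ B C → μF B C * θ^f C Y) ⟩
    ∑[ X , Y ] (λ C → ∑[ X , C ] (λ B → μF B C * θ^f C Y))
      ≡⟨ ∑[]-cong (λ {C} _ _ → sym (∑[]-*ʳ X C (θ^f C Y) (λ B → μF B C))) ⟩
    ∑[ X , Y ] (λ C → ∑[ X , C ] (λ B → μF B C) * θ^f C Y)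
      ≡⟨ ∑[]-cong (λ {C} X⊑C _ → cong (_* θ^f C Y) (∑μF-top X⊑C)) ⟩
    ∑[ X , Y ] (λ C → δ X C * θ^f C Y)
      ≡⟨ ∑[]-δ-bottom (λ C → θ^f C Y) X⊑Y ⟩
    θ^f X Y ∎
    where open ≡-Reasoning

  χ-complement-expansion : ∀ U →
    χ 𝟎 U * θ^f U 𝟏 ≡ ∑[ 𝟎 , 𝟏 ] (λ B → when (does (𝟎 ≟ᶠ B ∧ U)) (χ B 𝟏))
  χ-complement-expansion U = begin
    χ 𝟎 U * θ^f U 𝟏
      ≡⟨ ∑[]-*ʳ 𝟎 U (θ^f U 𝟏) (λ A → μF 𝟎 A * θ^f A U) ⟩
    ∑[ 𝟎 , U ] (λ A → μF 𝟎 A * θ^f A U * θ^f U 𝟏)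
      ≡⟨ ∑[]-cong (λ {A} _ A⊑U →
           trans (*-assoc (μF 𝟎 A) _ _) (cong (μF 𝟎 A *_) (θ^f-trans A⊑U (maximum U)))) ⟩
    ∑[ 𝟎 , U ] (λ A → μF 𝟎 A * θ^f A 𝟏)
      ≡⟨ ∑[]-cong (λ {A} _ _ → cong (μF 𝟎 A *_) (sym (∑χ-upper (maximum A)))) ⟩
    ∑[ 𝟎 , U ] (λ A → μF 𝟎 A * ∑[ A , 𝟏 ] (λ B → χ B 𝟏))
      ≡⟨ ∑[]-cong (λ {A} _ _ → ∑[]-*ˡ A 𝟏 (μF 𝟎 A) (λ B → χ B 𝟏)) ⟩
    ∑[ 𝟎 , U ] (λ A → ∑[ A , 𝟏 ] (λ B → μF 𝟎 A * χ B 𝟏))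
      ≡⟨ ∑[]-interchange-meet 𝟎 U 𝟏 (λ A B → μF 𝟎 A * χ B 𝟏) ⟩
    ∑[ 𝟎 , 𝟏 ] (λ B → ∑[ 𝟎 , B ∧ U ] (λ A → μF 𝟎 A * χ B 𝟏))
      ≡⟨ ∑[]-cong (λ {B} _ _ → sym (∑[]-*ʳ 𝟎 (B ∧ U) (χ B 𝟏) (μF 𝟎))) ⟩
    ∑[ 𝟎 , 𝟏 ] (λ B → ∑[ 𝟎 , B ∧ U ] (μF 𝟎) * χ B 𝟏)
      ≡⟨ ∑[]-cong (λ {B} _ _ → cong (_* χ B 𝟏) (∑μF-bottom (minimum (B ∧ U)))) ⟩
    ∑[ 𝟎 , 𝟏 ] (λ B → δ 𝟎 (B ∧ U) * χ B 𝟏)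
      ≡⟨ ∑[]-cong (λ {B} _ _ → when-1-* (does (𝟎 ≟ᶠ B ∧ U)) (χ B 𝟏)) ⟩
    ∑[ 𝟎 , 𝟏 ] (λ B → when (does (𝟎 ≟ᶠ B ∧ U)) (χ B 𝟏)) ∎
    where open ≡-Reasoning

  χ-disjoint-pos : (∀ X Y → X ⊑ Y → 0# ≤ χ X Y) →
                   ∀ T U → 0# < χ T 𝟏 → T ∧ U ≡ 𝟎 → 0# < χ 𝟎 U
  χ-disjoint-pos χ≥0 T U χT>0 T∧U≡𝟎 =
    nonneg-factor-pos (χ≥0 𝟎 U (minimum U))
      (<-≤-trans χT>0 (subst₂ _≤_ term-T (sym (χ-complement-expansion U)) (term≤sum term term≥0 T)))
    where
      term : L → Carrier
      term B = when (inInterval 𝟎 𝟏 B) (when (does (𝟎 ≟ᶠ B ∧ U)) (χ B 𝟏))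
      term≥0 : ∀ B → 0# ≤ term B
      term≥0 B = when-nonneg (inInterval 𝟎 𝟏 B)
                   (when-nonneg (does (𝟎 ≟ᶠ B ∧ U)) (χ≥0 B 𝟏 (maximum B)))
      term-T : term T ≡ χ T 𝟏
      term-T = trans (when-true _ (inInterval⁺ (minimum T) (maximum T)))
                     (when-true (χ T 𝟏) (T-does⁺ (𝟎 ≟ᶠ T ∧ U) (sym T∧U≡𝟎)))

corollary3p9 : (F : RealClosedField) (W : WeightedLattice) →
    let open RealClosedField F
        open WeightedLattice W
        open FinModLattice lattice renaming (_≤_ to _⊑_)
    in (θ : RealClosedField.Carrier F) → 0# < θ →
       (∀ X Y → X ⊑ Y → 0# ≤ charPoly F W X Y θ) →
       (T : FinModLattice.Carrier lattice) → 0# < charPoly F W T 𝟏 θ →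
       (U : FinModLattice.Carrier lattice) → IsComplement T U →
       0# < charPoly F W 𝟎 U θ
corollary3p9 F W θ _ charPoly≥0 T charPolyT>0 U (T∧U≡𝟎 , _) =
  subst (0# <_) (sym (charPoly≡χ 𝟎 U))
    (χ-disjoint-pos (λ X Y X⊑Y → subst (0# ≤_) (charPoly≡χ X Y) (charPoly≥0 X Y X⊑Y))
                    T U (subst (0# <_) (charPoly≡χ T 𝟏) charPolyT>0) T∧U≡𝟎)
  where
    open RealClosedField F
    open FinModLattice (WeightedLattice.lattice W) using (𝟎; 𝟏)
    open CharacteristicPolynomial F W θ
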